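{- Let $n\ge 1$, $k\in[n]$, and $\pi\in\mathfrak{S}_n$ with disjoint cycles $C_1,\dots,C_m$ (including fixed points as cycles of length $1$, indexed in increasing order of their minimal elements), where $C_i$ has length $\ell_i$, and let $p$ be the index with $k\in C_p$. Define $\ell'=(\ell'_1,\dots,\ell'_m)$ by $\ell'_i=\ell_i+1$ for $i\neq p$ and $\ell'_p=\ell_p$. Let $\alpha$ be a necklace containing exactly $\ell'_i$ copies of the letter $i$ for each $i\in[m]$. Then $\alpha\in\textsf{L-NCN}(\ell')$ if and only if $\alpha=\overline{\omega}$ for some valid word $\omega\in[m]^{n+m-2}$.
   Context: A necklace is a word considered up to cyclic rotation (read counterclockwise). For a sequence $x=(x_1,\dots,x_t)$ of positive integers with $N=x_1+\cdots+x_t$, $\textsf{L-NC}(x)$ is the set of words $w=w_1\cdots w_N$ over $[t]$ with exactly $x_i$ copies of $i$ for each $i$, such that there are no indices $a<b<c<d$ and letters $i\neq j$ with $w_a=w_c=i$ and $w_b=w_d=j$ (equivalently, labeled noncrossing partitions of $[N]$ whose part labeled $i$ has size $x_i$, the positions labeled $i$ forming that part). $\textsf{L-NCN}(x)$ is the set of rotation classes of elements of $\textsf{L-NC}(x)$ (labeled noncrossing necklaces). A word $\omega\in[m]^{n+m-2}$ is valid (for $\pi$ and pivot $k$) if: the letter $p$ appears $\ell_p-1$ times; each letter $j\neq p$ appears $\ell_j+1$ times; for $i\neq j$ there is no (not necessarily contiguous) subsequence $ijij$ in $\omega$; and for $i\neq p$ there is no (not necessarily contiguous) subsequence $ipi$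 in $\omega$. For a valid word $\omega$, $\overline{\omega}$ is the necklace obtained by inserting one extra letter $p$ between the last and first letters of $\omega$ (i.e. the rotation class of the word $\omega p$). -}

module Defs where

open import Data.Nat using (ℕ; zero; suc; _+_; _∸_; _≤_; _<_)
open import Data.Fin using (Fin; toℕ; _≟_)
import Data.Fin as F
open import Data.Fin.Permutation using (Permutation′; _⟨$⟩ʳ_)
open import Data.List using (List; []; _∷_; _++_; length; filter; lookup; upTo; allFin)
open import Data.List.Relation.Unary.Any using (Any; any?)
open import Data.List.Relation.Unary.All using (All; all?)
open import Data.List.Relation.Binary.Sublist.Propositional using (_⊆_)
open import Data.Product using (Σ; ∃; ∃-syntax; _×_; _,_)
open import Relation.Nullary using (¬_; Dec; yes; no)
open import Relation.Nullary.Decidable using (_→-dec_)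
open import Relation.Binary.PropositionalEquality using (_≡_; _≢_)
open import Relation.Unary using (Decidable)

iter : ∀ {n} → Permutation′ n → ℕ → Fin n → Fin n
iter π zero    x = x
iter π (suc j) x = π ⟨$⟩ʳ (iter π j x)

-- y lies in the cycle of x  (y = π^j x for some j < n; every orbit
-- element is reached within n steps)
Reach : ∀ {n} → Permutation′ n → Fin n → Fin n → Set
Reach {n} π x y = Any (λ j → iter π j x ≡ y) (upTo n)

reach? : ∀ {n} (π : Permutation′ n) (x : Fin n) → Decidable (Reach π x)
reach? {n} π x y = any? (λ j → iter π j x ≟ y) (upTo n)

IsLeader : ∀ {n} → Permutation′ n → Fin n → Set
IsLeader {n} π x = All (λ y → Reach π x y → toℕ x ≤ toℕ y) (allFin n)

isLeader? : ∀ {n} (π : Permutation′ n) → Decidable (IsLeader π)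
isLeader? {n} π x =
  all? (λ y → reach? π x y →-dec (toℕ x Data.Nat.≤? toℕ y)) (allFin n)

-- minimal elements of the cycles, in increasing order; the i-th one
-- determines the cycle C_i (cycles indexed by increasing minimal element)
leaders : ∀ {n} → Permutation′ n → List (Fin n)
leaders {n} π = filter (isLeader? π) (allFin n)

numCycles : ∀ {n} → Permutation′ n → ℕ
numCycles π = length (leaders π)

cycleElems : ∀ {n} (π : Permutation′ n) → Fin (numCycles π) → List (Fin n)
cycleElems {n} π i = filter (reach? π (lookup (leaders π) i)) (allFin n)

cycLen : ∀ {n} (π : Permutation′ n) → Fin (numCycles π) → ℕ
cycLen π i = length (cycleElems π i)

occ : ∀ {t} → Fin t → List (Fin t) → ℕ
occ a w = length (filter (_≟ a) w)

HasContent : ∀ {t} → (Fin t → ℕ) → List (Fin t) → Set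
HasContent x w = ∀ i → occ i w ≡ x i

NoncrossingWord : ∀ {t} → List (Fin t) → Set
NoncrossingWord w =
  (a b c d : Fin (length w)) → a F.< b → b F.< c → c F.< d →
  lookup w a ≡ lookup w c → lookup w b ≡ lookup w d →
  lookup w a ≡ lookup w b

LNC : ∀ {t} → (Fin t → ℕ) → List (Fin t) → Set
LNC x w = HasContent x w × NoncrossingWord w

IsRotation : ∀ {A : Set} → List A → List A → Set
IsRotation {A} w w' = Σ (List A) λ u → Σ (List A) λ v → (w ≡ u ++ v) × (w' ≡ v ++ u)

-- Necklaces are rotation classes of words; a necklace is represented by
-- any of its words w.  The necklace of w lies in L-NCN(x) iff some
-- rotation of w lies in L-NC(x).
InLNCN : ∀ {t} → (Fin t → ℕ) → List (Fin t) → Set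
InLNCN x w = ∃[ w' ] (IsRotation w w' × LNC x w')

-- the necklace ω̄ (rotation class of ω p) equals the necklace of w
BarEq : ∀ {t} → Fin t → List (Fin t) → List (Fin t) → Set
BarEq p ω w = IsRotation (ω ++ (p ∷ [])) w

ℓ′ : ∀ {m} → (Fin m → ℕ) → Fin m → Fin m → ℕ
ℓ′ ℓ p i with i ≟ p
... | yes _ = ℓ i
... | no  _ = suc (ℓ i)

Valid : ∀ (n m : ℕ) → (ℓ : Fin m → ℕ) → (p : Fin m) → List (Fin m) → Set
Valid n m ℓ p ω =
  (length ω ≡ n + m ∸ 2) ×
  (occ p ω + 1 ≡ ℓ p) ×
  (∀ j → j ≢ p → occ j ω ≡ suc (ℓ j)) ×
  (∀ i j → i ≢ j → ¬ ((i ∷ j ∷ i ∷ j ∷ []) ⊆ ω)) ×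
  (∀ i → i ≢ p → ¬ ((i ∷ p ∷ i ∷ []) ⊆ ω))

module Submission where

-- Only two facts about π matter: ℓ₁ + … + ℓₘ = n (the cycles partition [n])
-- and ℓ_p ≥ 1 (k ∈ C_p).  Backward: ω p itself
-- is a crossing-free representative of ω̄.

open import Defs
open import Data.Nat using (ℕ; zero; suc; _+_; _*_; _∸_; _≤_; _<_; _≤?_; z≤n; s≤s)
open import Data.Nat.Properties
  using ( +-0-commutativeMonoid; +-comm; +-assoc; +-suc; +-identityʳ; *-comm; m+n∸n≡m
        ; ≤-trans; ≤-reflexive; ≤-antisym; n<1+n; m≤n+m; ≰⇒>; m≤n⇒∃[o]m+o≡n)
open import Data.Nat.DivMod using (_%_; _/_; m≡m%n+[m/n]*n; m%n<n)
open import Data.Fin using (Fin; zero; suc; toℕ; _≟_; punchIn) renaming (_<_ to _<ᶠ_)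
open import Data.Fin.Patterns using (0F; 1F; 2F; 3F)
open import Data.Fin.Properties using (punchInᵢ≢i; pigeonhole; toℕ-injective; toℕ≤pred[n])
open import Data.Fin.Induction using (<-wellFounded)
open import Data.Fin.Permutation using (Permutation′; _⟨$⟩ʳ_; _⟨$⟩ˡ_; inverseˡ)
open import Data.List using (List; []; _∷_; _++_; length; filter; lookup; tabulate; allFin)
open import Data.List.Properties using (filter-++; length-++; ++-assoc)
open import Data.List.Relation.Unary.Any using (satisfied)
import Data.List.Relation.Unary.All as All
open import Data.List.Relation.Unary.All.Properties using (¬All⇒Any¬)
open import Data.List.Membership.Propositional using (lose)
open import Data.List.Membership.Propositional.Properties
  using (∈-upTo⁺; ∈-allFin; ∈-filter⁺; ∈-length)
open import Data.List.Relation.Binary.Sublist.Propositional using (_⊆_; []; _∷_; _∷ʳ_; minimum)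
open import Data.List.Relation.Binary.Sublist.Propositional.Properties using (++⁺; ++⁺ʳ)
open import Data.Product using (∃-syntax; _×_; _,_; proj₁; proj₂)
open import Data.Sum using (_⊎_; inj₁; inj₂)
open import Function.Base using (_∘_)
open import Function.Bundles using (_⇔_; mk⇔)
open import Induction.WellFounded using (Acc; acc)
open import Relation.Nullary using (¬_; Dec; yes; no)
open import Relation.Nullary.Decidable using (_→-dec_)
open import Relation.Nullary.Negation using (contradiction)
open import Relation.Unary using (Decidable)
open import Relation.Binary.PropositionalEquality
open import Algebra.Properties.CommutativeMonoid.Sum +-0-commutativeMonoid
  using (sum; sum-syntax; sum-cong-≗; sum-replicate-zero; sum-remove; ∑-distrib-+; ∑-comm)

keep : ∀ {P : Set} → Dec P → ℕ → ℕ
keep (yes _) x = x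
keep (no _)  _ = 0

keep-yes : ∀ {P : Set} (d : Dec P) {x} → P → keep d x ≡ x
keep-yes (yes _) _  = refl
keep-yes (no ¬p) p = contradiction p ¬p

keep-no : ∀ {P : Set} (d : Dec P) {x} → ¬ P → keep d x ≡ 0
keep-no (yes p) ¬p = contradiction p ¬p
keep-no (no _)  _  = refl

keep-∑ : ∀ {P : Set} (d : Dec P) {t} (f : Fin t → ℕ) →
  keep d (∑[ i < t ] f i) ≡ ∑[ i < t ] keep d (f i)
keep-∑ (yes _) f = refl
keep-∑ (no _) {t} f = sym (sum-replicate-zero t)

∑-ones : ∀ t → ∑[ i < t ] 1 ≡ t
∑-ones zero    = refl
∑-ones (suc t) = cong suc (∑-ones t)

∑-single : ∀ {t} (f : Fin t → ℕ) (z : Fin t) → (∀ i → i ≢ z → f i ≡ 0) →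
  ∑[ i < t ] f i ≡ f z
∑-single {suc t} f z vanish = begin
  sum f                       ≡⟨ sum-remove {i = z} f ⟩
  f z + sum (f ∘ punchIn z)   ≡⟨ cong (f z +_) (sum-cong-≗ (λ j → vanish _ (punchInᵢ≢i z j))) ⟩
  f z + ∑[ j < t ] 0          ≡⟨ cong (f z +_) (sum-replicate-zero t) ⟩
  f z + 0                     ≡⟨ +-identityʳ (f z) ⟩
  f z                         ∎
  where open ≡-Reasoning

∑-filter-tabulate : ∀ {A : Set} {n} (f : Fin n → A) {P : A → Set} (P? : Decidable P)
  (g : A → ℕ) → let xs = filter P? (tabulate f) in
  ∑[ i < length xs ] g (lookup xs i) ≡ ∑[ z < n ] keep (P? (f z)) (g (f z))
∑-filter-tabulate {n = zero} f P? g = refl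
∑-filter-tabulate {n = suc n} f P? g with P? (f zero)
... | yes _ = cong (g (f zero) +_) (∑-filter-tabulate (λ i → f (suc i)) P? g)
... | no _  = ∑-filter-tabulate (λ i → f (suc i)) P? g

length-filter-allFin : ∀ {n} {P : Fin n → Set} (P? : Decidable P) →
  length (filter P? (allFin n)) ≡ ∑[ y < n ] keep (P? y) 1
length-filter-allFin P? =
  trans (sym (∑-ones _)) (∑-filter-tabulate (λ y → y) P? (λ _ → 1))

-- Orbits of a permutation π of Fin n.  Every element has a unique cycle
-- leader (the least element of its orbit), hence the cycles partition
-- Fin n and their lengths add up to n.
module Cycles {n} (π : Permutation′ n) where

  _↝_ : Fin n → Fin n → Set
  x ↝ y = ∃[ j ] iter π j x ≡ y

  iter-+ : ∀ a b x → iter π (a + b) x ≡ iter π a (iter π b x)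
  iter-+ zero    b x = refl
  iter-+ (suc a) b x = cong (π ⟨$⟩ʳ_) (iter-+ a b x)

  iter-injective : ∀ a {u v} → iter π a u ≡ iter π a v → u ≡ v
  iter-injective zero    e = e
  iter-injective (suc a) e =
    iter-injective a (trans (sym (inverseˡ π)) (trans (cong (π ⟨$⟩ˡ_) e) (inverseˡ π)))

  -- Pigeonhole on x, πx, …, πⁿx: every orbit is periodic with period ≤ n.
  period : ∀ x → ∃[ d ] (suc d ≤ n × iter π (suc d) x ≡ x)
  period x with pigeonhole (n<1+n n) (λ i → iter π (toℕ i) x)
  ... | i , j , i<j , same with m≤n⇒∃[o]m+o≡n i<j
  ...   | d , i+1+d≡j = d , bound , back
    where
    j≡i+[1+d] : toℕ j ≡ toℕ i + suc d
    j≡i+[1+d] = trans (sym i+1+d≡j) (sym (+-suc (toℕ i) d))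
    bound : suc d ≤ n
    bound = ≤-trans (m≤n+m (suc d) (toℕ i))
              (≤-trans (≤-reflexive (sym j≡i+[1+d])) (toℕ≤pred[n] j))
    back : iter π (suc d) x ≡ x
    back = sym (iter-injective (toℕ i)
             (trans same (trans (cong (λ e → iter π e x) j≡i+[1+d]) (iter-+ (toℕ i) (suc d) x))))

  iter-multiple : ∀ {D x} → iter π D x ≡ x → ∀ c → iter π (c * D) x ≡ x
  iter-multiple e zero = refl
  iter-multiple {D} {x} e (suc c) =
    trans (iter-+ D (c * D) x) (trans (cong (iter π D) (iter-multiple e c)) e)

  ↝-trans : ∀ {x y z} → x ↝ y → y ↝ z → x ↝ z
  ↝-trans {x} (a , e₁) (b , e₂) = b + a , trans (iter-+ b a x) (trans (cong (iter π b) e₁) e₂)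

  -- Going once more around the cycle of x leads from y = πʲx back to x.
  ↝-sym : ∀ {x y} → x ↝ y → y ↝ x
  ↝-sym {x} (j , refl) with period x
  ... | d , _ , back = d * j , (begin
    iter π (d * j) (iter π j x)  ≡⟨ sym (iter-+ (d * j) j x) ⟩
    iter π (d * j + j) x         ≡⟨ cong (λ e → iter π e x) (+-comm (d * j) j) ⟩
    iter π (suc d * j) x         ≡⟨ cong (λ e → iter π e x) (*-comm (suc d) j) ⟩
    iter π (j * suc d) x         ≡⟨ iter-multiple back j ⟩
    x                            ∎)
    where open ≡-Reasoning

  Reach⇒↝ : ∀ {x y} → Reach π x y → x ↝ y
  Reach⇒↝ = satisfied

  -- Reducing the exponent modulo the period brings it below n.
  ↝⇒Reach : ∀ {x y} → x ↝ y → Reach π x y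
  ↝⇒Reach {x} (j , refl) with period x
  ... | d , D≤n , back = lose (∈-upTo⁺ (≤-trans (m%n<n j (suc d)) D≤n)) (begin
    iter π (j % suc d) x                          ≡⟨ cong (iter π (j % suc d)) (sym (iter-multiple back (j / suc d))) ⟩
    iter π (j % suc d) (iter π (j / suc d * suc d) x) ≡⟨ sym (iter-+ (j % suc d) _ x) ⟩
    iter π (j % suc d + j / suc d * suc d) x      ≡⟨ cong (λ e → iter π e x) (sym (m≡m%n+[m/n]*n j (suc d))) ⟩
    iter π j x                                    ∎)
    where open ≡-Reasoning

  leader-minimal : ∀ {z y} → IsLeader π z → Reach π z y → toℕ z ≤ toℕ y
  leader-minimal {y = y} L = All.lookup L (∈-allFin y)

  smaller-in-cycle : ∀ c → ¬ IsLeader π c → ∃[ w ] (Reach π c w × toℕ w < toℕ c)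
  smaller-in-cycle c ¬L
    with satisfied (¬All⇒Any¬ (λ y → reach? π c y →-dec (toℕ c ≤? toℕ y)) (allFin n) ¬L)
  ... | w , ¬minimal with reach? π c w
  ...   | yes r  = w , r , ≰⇒> (λ c≤w → ¬minimal (λ _ → c≤w))
  ...   | no ¬r  = contradiction (λ r → contradiction r ¬r) ¬minimal

  -- Descending to ever smaller elements of the cycle ends at its leader.
  leader-exists : ∀ y → ∃[ z ] (IsLeader π z × z ↝ y)
  leader-exists y = descend y (<-wellFounded y) (0 , refl)
    where
    descend : ∀ c → Acc _<ᶠ_ c → c ↝ y → ∃[ z ] (IsLeader π z × z ↝ y)
    descend c (acc smaller) c↝y with isLeader? π c
    ... | yes L  = c , L , c↝y
    ... | no ¬L with smaller-in-cycle c ¬L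
    ...   | w , c→w , w<c = descend w (smaller w<c) (↝-trans (↝-sym (Reach⇒↝ c→w)) c↝y)

  leader-unique : ∀ {z₁ z₂ y} → IsLeader π z₁ → IsLeader π z₂ → z₁ ↝ y → z₂ ↝ y → z₁ ≡ z₂
  leader-unique L₁ L₂ r₁ r₂ = toℕ-injective (≤-antisym
    (leader-minimal L₁ (↝⇒Reach (↝-trans r₁ (↝-sym r₂))))
    (leader-minimal L₂ (↝⇒Reach (↝-trans r₂ (↝-sym r₁)))))

  cycles-partition : ∀ y → ∑[ z < n ] keep (isLeader? π z) (keep (reach? π z y) 1) ≡ 1
  cycles-partition y with leader-exists y
  ... | z , L , z↝y =
    trans (∑-single _ z others) (trans (keep-yes (isLeader? π z) L) (keep-yes (reach? π z y) (↝⇒Reach z↝y)))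
    where
    others : ∀ i → i ≢ z → keep (isLeader? π i) (keep (reach? π i y) 1) ≡ 0
    others i i≢z with isLeader? π i | reach? π i y
    ... | yes Lᵢ | yes rᵢ = contradiction (leader-unique Lᵢ L (Reach⇒↝ rᵢ) z↝y) i≢z
    ... | yes _  | no _   = refl
    ... | no _   | _      = refl

  -- Σᵢ ℓᵢ = n: count pairs (leader z, element y of its cycle) both ways.
  cycle-lengths-sum : ∑[ i < numCycles π ] cycLen π i ≡ n
  cycle-lengths-sum = begin
    ∑[ i < numCycles π ] size (lookup (leaders π) i)      ≡⟨ ∑-filter-tabulate (λ z → z) (isLeader? π) size ⟩
    ∑[ z < n ] keep (isLeader? π z) (size z)             ≡⟨ sum-cong-≗ (λ z → cong (keep (isLeader? π z)) (length-filter-allFin (reach? π z))) ⟩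
    ∑[ z < n ] keep (isLeader? π z) (∑[ y < n ] χ z y)    ≡⟨ sum-cong-≗ (λ z → keep-∑ (isLeader? π z) (χ z)) ⟩
    ∑[ z < n ] ∑[ y < n ] keep (isLeader? π z) (χ z y)   ≡⟨ ∑-comm (λ z y → keep (isLeader? π z) (χ z y)) ⟩
    ∑[ y < n ] ∑[ z < n ] keep (isLeader? π z) (χ z y)   ≡⟨ sum-cong-≗ cycles-partition ⟩
    ∑[ y < n ] 1                                          ≡⟨ ∑-ones n ⟩
    n                                                     ∎
    where
    open ≡-Reasoning
    size : Fin n → ℕ
    size z = length (filter (reach? π z) (allFin n))
    χ : Fin n → Fin n → ℕ
    χ z y = keep (reach? π z y) 1

  cycle-nonempty : ∀ p {k} → Reach π (lookup (leaders π) p) k → 1 ≤ cycLen π p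
  cycle-nonempty p k∈Cₚ = ∈-length (∈-filter⁺ (reach? π _) (∈-allFin _) k∈Cₚ)

module _ {t : ℕ} where

  occ-∷ : ∀ (i a : Fin t) w → occ i (a ∷ w) ≡ keep (a ≟ i) 1 + occ i w
  occ-∷ i a w with a ≟ i
  ... | yes _ = refl
  ... | no _  = refl

  occ-++ : ∀ (i : Fin t) u v → occ i (u ++ v) ≡ occ i u + occ i v
  occ-++ i u v = trans (cong length (filter-++ (_≟ i) u v)) (length-++ (filter (_≟ i) u))

  occ-snoc : ∀ (i a : Fin t) w → occ i (w ++ a ∷ []) ≡ occ i w + keep (a ≟ i) 1
  occ-snoc i a w = trans (occ-++ i w (a ∷ []))
    (cong (occ i w +_) (trans (occ-∷ i a []) (+-identityʳ (keep (a ≟ i) 1))))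

  ∑-indicator : ∀ (a : Fin t) → ∑[ i < t ] keep (a ≟ i) 1 ≡ 1
  ∑-indicator a = trans (∑-single _ a (λ i i≢a → keep-no (a ≟ i) (i≢a ∘ sym))) (keep-yes (a ≟ a) refl)

  length-occ : (w : List (Fin t)) → length w ≡ ∑[ i < t ] occ i w
  length-occ []      = sym (sum-replicate-zero t)
  length-occ (a ∷ w) = begin
    1 + length w                                       ≡⟨ cong₂ _+_ (sym (∑-indicator a)) (length-occ w) ⟩
    ∑[ i < t ] keep (a ≟ i) 1 + ∑[ i < t ] occ i w     ≡⟨ sym (∑-distrib-+ (λ i → keep (a ≟ i) 1) (λ i → occ i w)) ⟩
    ∑[ i < t ] (keep (a ≟ i) 1 + occ i w)              ≡⟨ sum-cong-≗ (λ i → sym (occ-∷ i a w)) ⟩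
    ∑[ i < t ] occ i (a ∷ w)                           ∎
    where open ≡-Reasoning

  rotation-content : ∀ {x : Fin t → ℕ} {w w′} → IsRotation w w′ → HasContent x w → HasContent x w′
  rotation-content (u , v , refl , refl) has i =
    trans (occ-++ i v u) (trans (+-comm (occ i v) (occ i u)) (trans (sym (occ-++ i u v)) (has i)))

  occurrence : ∀ (a : Fin t) w → 1 ≤ occ a w → ∃[ x ] ∃[ y ] (w ≡ x ++ a ∷ y)
  occurrence a []      ()
  occurrence a (b ∷ w) present with b ≟ a
  ... | yes refl = [] , w , refl
  ... | no _ with occurrence a w present
  ...   | x , y , refl = b ∷ x , y , refl

  ℓ′-pivot : ∀ (ℓ : Fin t → ℕ) p → ℓ′ ℓ p p ≡ ℓ p
  ℓ′-pivot ℓ p with p ≟ p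
  ... | yes _   = refl
  ... | no p≢p  = contradiction refl p≢p

  ℓ′-other : ∀ (ℓ : Fin t → ℕ) p j → j ≢ p → ℓ′ ℓ p j ≡ suc (ℓ j)
  ℓ′-other ℓ p j j≢p with j ≟ p
  ... | yes j≡p = contradiction j≡p j≢p
  ... | no _    = refl

  ℓ′-correction : ∀ (ℓ : Fin t → ℕ) p i → ℓ′ ℓ p i + keep (p ≟ i) 1 ≡ suc (ℓ i)
  ℓ′-correction ℓ p i with p ≟ i
  ... | yes refl = trans (cong (_+ 1) (ℓ′-pivot ℓ p)) (+-comm (ℓ p) 1)
  ... | no p≢i   = trans (+-identityʳ _) (ℓ′-other ℓ p i (p≢i ∘ sym))

  ∑-ℓ′ : ∀ (ℓ : Fin t → ℕ) p → ∑[ i < t ] ℓ′ ℓ p i + 1 ≡ ∑[ i < t ] ℓ i + t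
  ∑-ℓ′ ℓ p = begin
    ∑[ i < t ] ℓ′ ℓ p i + 1                                ≡⟨ cong (sum (ℓ′ ℓ p) +_) (sym (∑-indicator p)) ⟩
    ∑[ i < t ] ℓ′ ℓ p i + ∑[ i < t ] keep (p ≟ i) 1        ≡⟨ sym (∑-distrib-+ (ℓ′ ℓ p) _) ⟩
    ∑[ i < t ] (ℓ′ ℓ p i + keep (p ≟ i) 1)                 ≡⟨ sum-cong-≗ (ℓ′-correction ℓ p) ⟩
    ∑[ i < t ] suc (ℓ i)                                   ≡⟨ sum-cong-≗ (λ i → +-comm 1 (ℓ i)) ⟩
    ∑[ i < t ] (ℓ i + 1)                                   ≡⟨ ∑-distrib-+ ℓ (λ _ → 1) ⟩
    ∑[ i < t ] ℓ i + ∑[ i < t ] 1                          ≡⟨ cong (sum ℓ +_) (∑-ones t) ⟩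
    ∑[ i < t ] ℓ i + t                                     ∎
    where open ≡-Reasoning

-- Patterns: s ⊆ w means that s occurs in w as a (scattered) subword.
module _ {A : Set} where

  AvoidsABAB : List A → Set
  AvoidsABAB w = ∀ i j → i ≢ j → ¬ ((i ∷ j ∷ i ∷ j ∷ []) ⊆ w)

  split : ∀ (u : List A) {v s} → s ⊆ u ++ v →
    ∃[ s₁ ] ∃[ s₂ ] (s ≡ s₁ ++ s₂ × s₁ ⊆ u × s₂ ⊆ v)
  split []      {s = s} τ = [] , s , refl , [] , τ
  split (y ∷ u) (.y ∷ʳ τ) with split u τ
  ... | s₁ , s₂ , refl , τ₁ , τ₂ = s₁ , s₂ , refl , y ∷ʳ τ₁ , τ₂
  split (y ∷ u) (refl ∷ τ) with split u τ
  ... | s₁ , s₂ , refl , τ₁ , τ₂ = y ∷ s₁ , s₂ , refl , refl ∷ τ₁ , τ₂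

  rotate-abab : ∀ {i j : A} s₁ s₂ → i ∷ j ∷ i ∷ j ∷ [] ≡ s₁ ++ s₂ →
    (s₂ ++ s₁ ≡ i ∷ j ∷ i ∷ j ∷ []) ⊎ (s₂ ++ s₁ ≡ j ∷ i ∷ j ∷ i ∷ [])
  rotate-abab []                    _  refl = inj₁ refl
  rotate-abab (_ ∷ [])              _  refl = inj₂ refl
  rotate-abab (_ ∷ _ ∷ [])          _  refl = inj₁ refl
  rotate-abab (_ ∷ _ ∷ _ ∷ [])      _  refl = inj₂ refl
  rotate-abab (_ ∷ _ ∷ _ ∷ _ ∷ [])  [] refl = inj₁ refl

  -- Avoiding i j i j is a property of necklaces: it is invariant under rotation.
  avoids-rotate : ∀ u v → AvoidsABAB (v ++ u) → AvoidsABAB (u ++ v)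
  avoids-rotate u v avoids i j i≢j τ with split u τ
  ... | s₁ , s₂ , e , τ₁ , τ₂ = excluded (rotate-abab s₁ s₂ e) (++⁺ τ₂ τ₁)
    where
    excluded : ∀ {s} → (s ≡ i ∷ j ∷ i ∷ j ∷ []) ⊎ (s ≡ j ∷ i ∷ j ∷ i ∷ []) → ¬ (s ⊆ v ++ u)
    excluded (inj₁ refl) = avoids i j i≢j
    excluded (inj₂ refl) = avoids j i (i≢j ∘ sym)

  AvoidsIAI : A → List A → Set
  AvoidsIAI a w = ∀ i → i ≢ a → ¬ ((i ∷ a ∷ i ∷ []) ⊆ w)

  -- Appending a letter a keeps i j i j away exactly when w avoids both
  -- i j i j and i a i: a new crossing must use the appended a as its last letter.
  snoc-avoids⁻ : ∀ {a} w → AvoidsABAB (w ++ a ∷ []) → AvoidsABAB w × AvoidsIAI a w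
  snoc-avoids⁻ {a} w avoids =
    (λ i j i≢j τ → avoids i j i≢j (++⁺ʳ (a ∷ []) τ)) ,
    (λ i i≢a τ → avoids i a i≢a (++⁺ τ (refl ∷ [])))

  snoc-avoids⁺ : ∀ {a} w → AvoidsABAB w → AvoidsIAI a w → AvoidsABAB (w ++ a ∷ [])
  snoc-avoids⁺ w abab iai i j i≢j τ with split w τ
  ... | _ ∷ _ ∷ _ ∷ _ ∷ [] , []     , refl , τ₁ , _          = abab i j i≢j τ₁
  ... | _ ∷ _ ∷ _ ∷ []     , _ ∷ [] , refl , τ₁ , refl ∷ []  = iai i i≢j τ₁
  ... | _ ∷ _ ∷ _ ∷ []     , _ ∷ [] , refl , _  , _ ∷ʳ ()
  ... | _ ∷ _ ∷ []         , _      , refl , _  , _ ∷ʳ ()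
  ... | _ ∷ _ ∷ []         , _      , refl , _  , _ ∷ ()
  ... | _ ∷ []             , _      , refl , _  , _ ∷ʳ ()
  ... | _ ∷ []             , _      , refl , _  , _ ∷ ()
  ... | []                 , _      , refl , _  , _ ∷ʳ ()
  ... | []                 , _      , refl , _  , _ ∷ ()

  position : ∀ {s w : List A} → s ⊆ w → Fin (length s) → Fin (length w)
  position (y ∷ʳ τ) i       = suc (position τ i)
  position (_ ∷ τ)  zero    = zero
  position (_ ∷ τ)  (suc i) = suc (position τ i)

  position-lookup : ∀ {s w : List A} (τ : s ⊆ w) i → lookup w (position τ i) ≡ lookup s i
  position-lookup (y ∷ʳ τ)   i       = position-lookup τ i
  position-lookup (refl ∷ τ) zero    = refl
  position-lookup (_ ∷ τ)    (suc i) = position-lookup τ i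

  position-mono : ∀ {s w : List A} (τ : s ⊆ w) {i j} → i <ᶠ j → position τ i <ᶠ position τ j
  position-mono (y ∷ʳ τ) i<j                       = s≤s (position-mono τ i<j)
  position-mono (_ ∷ τ)  {zero}  {suc j} _         = s≤s z≤n
  position-mono (_ ∷ τ)  {suc i} {suc j} (s≤s i<j) = s≤s (position-mono τ i<j)

  lookup-⊆₁ : ∀ (w : List A) a → lookup w a ∷ [] ⊆ w
  lookup-⊆₁ (x ∷ w) zero    = refl ∷ minimum w
  lookup-⊆₁ (x ∷ w) (suc a) = x ∷ʳ lookup-⊆₁ w a

  lookup-⊆₂ : ∀ (w : List A) a b → a <ᶠ b → lookup w a ∷ lookup w b ∷ [] ⊆ w
  lookup-⊆₂ (x ∷ w) zero    (suc b) _         = refl ∷ lookup-⊆₁ w b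
  lookup-⊆₂ (x ∷ w) (suc a) (suc b) (s≤s a<b) = x ∷ʳ lookup-⊆₂ w a b a<b

  lookup-⊆₃ : ∀ (w : List A) a b c → a <ᶠ b → b <ᶠ c →
    lookup w a ∷ lookup w b ∷ lookup w c ∷ [] ⊆ w
  lookup-⊆₃ (x ∷ w) zero    (suc b) (suc c) _         (s≤s b<c) = refl ∷ lookup-⊆₂ w b c b<c
  lookup-⊆₃ (x ∷ w) (suc a) (suc b) (suc c) (s≤s a<b) (s≤s b<c) = x ∷ʳ lookup-⊆₃ w a b c a<b b<c

  lookup-⊆₄ : ∀ (w : List A) a b c d → a <ᶠ b → b <ᶠ c → c <ᶠ d →
    lookup w a ∷ lookup w b ∷ lookup w c ∷ lookup w d ∷ [] ⊆ w
  lookup-⊆₄ (x ∷ w) zero    (suc b) (suc c) (suc d) _         (s≤s b<c) (s≤s c<d) =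
    refl ∷ lookup-⊆₃ w b c d b<c c<d
  lookup-⊆₄ (x ∷ w) (suc a) (suc b) (suc c) (suc d) (s≤s a<b) (s≤s b<c) (s≤s c<d) =
    x ∷ʳ lookup-⊆₄ w a b c d a<b b<c c<d

module _ {t : ℕ} where

  noncrossing⇒avoids : (w : List (Fin t)) → NoncrossingWord w → AvoidsABAB w
  noncrossing⇒avoids w noncrossing i j i≢j τ =
    i≢j (trans (sym (at 0F)) (trans (noncrossing _ _ _ _ (mono 0<1) (mono 1<2) (mono 2<3)
      (trans (at 0F) (sym (at 2F))) (trans (at 1F) (sym (at 3F)))) (at 1F)))
    where
    at = position-lookup τ
    mono = position-mono τ
    0<1 : _<ᶠ_ {4} {4} 0F 1F
    0<1 = s≤s z≤n
    1<2 : _<ᶠ_ {4} {4} 1F 2F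
    1<2 = s≤s (s≤s z≤n)
    2<3 : _<ᶠ_ {4} {4} 2F 3F
    2<3 = s≤s (s≤s (s≤s z≤n))

  avoids⇒noncrossing : (w : List (Fin t)) → AvoidsABAB w → NoncrossingWord w
  avoids⇒noncrossing w avoids a b c d a<b b<c c<d wa≡wc wb≡wd with lookup w a ≟ lookup w b
  ... | yes wa≡wb = wa≡wb
  ... | no wa≢wb  = contradiction
    (subst₂ (λ x y → lookup w a ∷ lookup w b ∷ x ∷ y ∷ [] ⊆ w) (sym wa≡wc) (sym wb≡wd)
      (lookup-⊆₄ w a b c d a<b b<c c<d))
    (avoids _ _ wa≢wb)

module _ {A : Set} where

  rotation-sym : ∀ {w w′ : List A} → IsRotation w w′ → IsRotation w′ w
  rotation-sym (u , v , w≡uv , w′≡vu) = v , u , w′≡vu , w≡uv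

  rotation-avoids : ∀ {w w′ : List A} → IsRotation w w′ → AvoidsABAB w → AvoidsABAB w′
  rotation-avoids (u , v , refl , refl) = avoids-rotate v u

  rotate-after : ∀ x (a : A) y → IsRotation (x ++ a ∷ y) ((y ++ x) ++ a ∷ [])
  rotate-after x a y = x ++ a ∷ [] , y , sym (++-assoc x (a ∷ []) y) , ++-assoc y x (a ∷ [])

module _ {m} (ℓ : Fin m → ℕ) (p : Fin m) where

  snoc-counts : ∀ ω → HasContent (ℓ′ ℓ p) (ω ++ p ∷ []) →
    (occ p ω + 1 ≡ ℓ p) × (∀ j → j ≢ p → occ j ω ≡ suc (ℓ j))
  snoc-counts ω has = pivot , other
    where
    pivot : occ p ω + 1 ≡ ℓ p
    pivot = begin
      occ p ω + 1                  ≡⟨ cong (occ p ω +_) (sym (keep-yes (p ≟ p) refl)) ⟩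
      occ p ω + keep (p ≟ p) 1     ≡⟨ sym (occ-snoc p p ω) ⟩
      occ p (ω ++ p ∷ [])          ≡⟨ has p ⟩
      ℓ′ ℓ p p                     ≡⟨ ℓ′-pivot ℓ p ⟩
      ℓ p                          ∎
      where open ≡-Reasoning
    other : ∀ j → j ≢ p → occ j ω ≡ suc (ℓ j)
    other j j≢p = begin
      occ j ω                      ≡⟨ sym (+-identityʳ (occ j ω)) ⟩
      occ j ω + 0                  ≡⟨ cong (occ j ω +_) (sym (keep-no (p ≟ j) (j≢p ∘ sym))) ⟩
      occ j ω + keep (p ≟ j) 1     ≡⟨ sym (occ-snoc j p ω) ⟩
      occ j (ω ++ p ∷ [])          ≡⟨ has j ⟩
      ℓ′ ℓ p j                     ≡⟨ ℓ′-other ℓ p j j≢p ⟩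
      suc (ℓ j)                    ∎
      where open ≡-Reasoning

  -- |ω| + 2 = |ℓ′| + 1 = |ℓ| + m.
  snoc-length : ∀ n → ∑[ i < m ] ℓ i ≡ n → ∀ ω → HasContent (ℓ′ ℓ p) (ω ++ p ∷ []) →
    length ω ≡ n + m ∸ 2
  snoc-length n total ω has = trans (sym (m+n∸n≡m (length ω) 2)) (cong (_∸ 2) (begin
    length ω + 2                        ≡⟨ sym (+-assoc (length ω) 1 1) ⟩
    length ω + 1 + 1                    ≡⟨ cong (_+ 1) (sym (length-++ ω)) ⟩
    length (ω ++ p ∷ []) + 1            ≡⟨ cong (_+ 1) (length-occ (ω ++ p ∷ [])) ⟩
    ∑[ i < m ] occ i (ω ++ p ∷ []) + 1  ≡⟨ cong (_+ 1) (sum-cong-≗ has) ⟩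
    ∑[ i < m ] ℓ′ ℓ p i + 1             ≡⟨ ∑-ℓ′ ℓ p ⟩
    ∑[ i < m ] ℓ i + m                  ≡⟨ cong (_+ m) total ⟩
    n + m                               ∎))
    where open ≡-Reasoning

  -- Cut α after an occurrence x p of the pivot letter: α = x p y gives ω = y x.
  necklace⇒valid : ∀ n → ∑[ i < m ] ℓ i ≡ n → 1 ≤ ℓ p → ∀ α → HasContent (ℓ′ ℓ p) α →
    InLNCN (ℓ′ ℓ p) α → ∃[ ω ] (Valid n m ℓ p ω × BarEq p ω α)
  necklace⇒valid n total pivot-used α has (w , α↻w , _ , noncrossing)
    with occurrence p α (subst (1 ≤_) (sym (trans (has p) (ℓ′-pivot ℓ p))) pivot-used)
  ... | x , y , refl = y ++ x , valid , rotation-sym cut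
    where
    cut = rotate-after x p y
    has-ωp = rotation-content cut has
    avoids-ωp = rotation-avoids cut (rotation-avoids (rotation-sym α↻w) (noncrossing⇒avoids w noncrossing))
    counts = snoc-counts (y ++ x) has-ωp
    valid : Valid n m ℓ p (y ++ x)
    valid = snoc-length n total (y ++ x) has-ωp , proj₁ counts , proj₂ counts ,
            snoc-avoids⁻ (y ++ x) avoids-ωp

  -- Conversely ω p itself is a crossing-free representative of ω̄.
  valid⇒necklace : ∀ n α → HasContent (ℓ′ ℓ p) α →
    ∃[ ω ] (Valid n m ℓ p ω × BarEq p ω α) → InLNCN (ℓ′ ℓ p) α
  valid⇒necklace n α has (ω , (_ , _ , _ , abab , ipi) , ωp↻α) =
    ω ++ p ∷ [] , rotation-sym ωp↻α , rotation-content (rotation-sym ωp↻α) has ,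
    avoids⇒noncrossing (ω ++ p ∷ []) (snoc-avoids⁺ ω abab ipi)

  necklace⇔valid : ∀ n → ∑[ i < m ] ℓ i ≡ n → 1 ≤ ℓ p → ∀ α → HasContent (ℓ′ ℓ p) α →
    InLNCN (ℓ′ ℓ p) α ⇔ (∃[ ω ] (Valid n m ℓ p ω × BarEq p ω α))
  necklace⇔valid n total pivot-used α has =
    mk⇔ (necklace⇒valid n total pivot-used α has) (valid⇒necklace n α has)

proposition2p9 : (n : ℕ) → 1 ≤ n → (k : Fin n) → (π : Permutation′ n) →
    (p : Fin (numCycles π)) → Reach π (lookup (leaders π) p) k →
    (α : List (Fin (numCycles π))) → HasContent (ℓ′ (cycLen π) p) α →
    InLNCN (ℓ′ (cycLen π) p) α ⇔
      (∃[ ω ] (Valid n (numCycles π) (cycLen π) p ω × BarEq p ω α))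
proposition2p9 n _ k π p k∈Cₚ α has =
  necklace⇔valid (cycLen π) p n cycle-lengths-sum (cycle-nonempty p k∈Cₚ) α has
  where open Cycles π
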